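{- Let $G=\langle S_1,S_2,A_1,A_2,\delta\rangle$ be a stochastic graph game with variables $\mathit{Var}=\mathit{Var}_S\uplus\mathit{Var}_A$ over a finite domain $X\subseteq\mathbb{N}$, let $i\in\{1,2\}$, and let $\pi\colon S_i\to A_i$ be a memoryless strategy for player $i$. Let $\mathit{Train}=\mathit{Good}\uplus\mathit{Bad}\subseteq X^{|\mathit{Var}|}$ be the training set defined by $\pi$. Consider an arbitrary split procedure which, whenever it is called on a dataset $D$, returns a predicate from the finite predicate set $\mathit{Preds}$ whose sat-partition $D[\varphi]$ and unsat-partition $D[\neg\varphi]$ are both nonempty. Then Algorithm LinDT (described in the context), given $\mathit{Train}$ as input and using this split procedure, terminates and outputs a decision tree with linear classifiers $\mathcal{T}$ such that $\mathcal{L}(\mathcal{T})\cap\mathit{Train}=\mathit{Good}$; that is, for all $s\in S_i$ and $a\in A_i$ we have $(s,a)\in\mathcal{L}(\mathcal{T})$ if and only if $\pi(s)=a$. Thus $\mathcal{T}$ represents the strategy $\pi$.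
   Context: Stochastic graph game: $S_1,S_2$ are finite sets of states of player 1 and player 2 ($S=S_1\cup S_2$), $A_1,A_2$ finite sets of actions ($A=A_1\cup A_2$), and $\delta\colon (S_1\times A_1)\cup(S_2\times A_2)\to\mathcal{D}(S)$ is a transition function to probability distributions over $S$. A memoryless strategy for player $i$ is a function $\pi\colon S_i\to A_i$. Variables: $\mathit{Var}$ is a finite set of variables over a finite $X\subseteq\mathbb{N}$, partitioned into state-variables $\mathit{Var}_S$ and action-variables $\mathit{Var}_A$; each state $s$ is associated with a unique valuation $\mathit{val}_s\in X^{\mathit{Var}_S}$ and each action $a$ with a unique valuation $\mathit{val}_a\in X^{\mathit{Var}_A}$. A state-action pair $(s,a)$ is identified with the vector in $X^{|\mathit{Var}|}$ formed by $\mathit{val}_s$ and $\mathit{val}_a$. The training set defined by $\pi$: $\mathit{Good}=\{(s,\pi(s)) : s\in S_i\}$, $\mathit{Bad}=\{(s,a)\in S_i\times A_i : a\neq\pi(s)\}$, $\mathit{Train}=\mathit{Good}\uplus\mathit{Bad}$. Predicates: $\mathit{Preds}$ is a finite set of (in)equality predicates over the variables $x_1,\dots,x_d$ ($d=|\mathit{Var}|$) comparing values of variables to constants. For a dataset $D$ and predicate $\varphi$, $D[\varphi]$ is the set of elements of $D$ satisfying $\varphi$, $D[\neg\varphi]$ those not satisfying it. Linear classifier: for $\vec w\in\mathbb{R}^d$, $b\in\mathbb{R}$, $c_{\vec w,b}(\vec x)=\mathrm{YES}$ if $\vec w\cdot\vec x\ge b$ and $\mathrm{NO}$ otherwise. A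 dataset $D=D_G\uplus D_B$ (with $D_G=D\cap\mathit{Good}$, $D_B=D\cap\mathit{Bad}$) is linearly separable by $c_{\vec w,b}$ if for every $\vec x\in D$, $c_{\vec w,b}(\vec x)=\mathrm{YES}$ iff $\vec x\in\mathit{Good}$. Decision tree with linear classifiers: $\mathcal{T}=(T,\rho,\theta)$ where $T$ is a finite rooted binary ordered tree, $\rho$ assigns to every inner node a predicate from $\mathit{Preds}$, and $\theta$ assigns to every leaf either $\mathrm{YES}$, $\mathrm{NO}$, or a linear classifier. For $\vec x\in\mathbb{N}^d$, follow the path from the root where at each inner node $n$ one goes to the first child iff $\rho(n)(\vec x)$ is true; at the reached leaf $\ell$, $\vec x\in\mathcal{L}(\mathcal{T})$ iff $\theta(\ell)=\mathrm{YES}$, or $\theta(\ell)$ is a classifier $c$ with $c(\vec x)=\mathrm{YES}$. Algorithm LinDT: start with a tree consisting only of the root and a queue containing $(\mathit{root},\mathit{Train})$. While the queue is nonempty, pop $(\ell,D_\ell)$. If $D_\ell\subseteq\mathit{Good}$ or $D_\ell\subseteq\mathit{Bad}$, set $\theta(\ell)=\mathrm{YES}$ if $|D_\ell\cap\mathit{Good}|\ge|D_\ell\cap\mathit{Bad}|$ and $\mathrm{NO}$ otherwise. Else, if $D_\ell$ is linearly separable by some classifier $c_{\vec w,b}$, set $\theta(\ell)=c_{\vec w,b}$. Otherwise set $\rho(\ell)$ to the predicate returned by the split procedure on $D_\ell$, create children $\ell_{sat}$ (first) and $\ell_{unsat}$ (second) of $\ell$, and push $(\ell_{sat},D_\ell[\rho(\ell)])$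 and $(\ell_{unsat},D_\ell[\neg\rho(\ell)])$. When the queue is empty, return the tree.
   Formalization: The linear classifiers, both those placed at leaves and those in LinDT's separability test, have rational weights $\vec w$ and threshold $b$ rather than real ones. -}

module Defs where

open import Data.Bool using (Bool; true; false; if_then_else_; _∧_; not)
open import Data.Nat as ℕ using (ℕ; _+_; _≤ᵇ_; _≡ᵇ_)
open import Data.Integer using (+_)
open import Data.Rational as ℚ using (ℚ; 0ℚ; _≤?_)
open import Data.Fin using (Fin)
open import Data.Vec as Vec using (Vec; _++_; lookup)
open import Data.Vec.Properties using (≡-dec)
open import Data.List as List using (List; []; _∷_; map; concatMap; filterᵇ; allFin; length; filter)
open import Data.List.Relation.Unary.All using (All; all?)
open import Data.List.Membership.Propositional using (_∈_)
import Data.List.Membership.DecPropositional as DecMem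
open import Data.Maybe using (Maybe; just; nothing)
open import Data.Product using (Σ; ∃; _×_; _,_)
open import Function.Bundles using (_⇔_)
open import Relation.Nullary using (Dec; yes; no; ¬_)
open import Relation.Nullary.Decidable using (⌊_⌋)
open import Relation.Binary.PropositionalEquality using (_≡_)

Point : ℕ → Set
Point d = Vec ℕ d

Dataset : ℕ → Set
Dataset d = List (Point d)

data Cmp : Set where
  EQ NE LT LE GT GE : Cmp

record Pred (d : ℕ) : Set where
  constructor pred
  field
    var   : Fin d
    op    : Cmp
    const : ℕ

evalCmp : Cmp → ℕ → ℕ → Bool
evalCmp EQ x c = x ≡ᵇ c
evalCmp NE x c = not (x ≡ᵇ c)
evalCmp LT x c = ℕ.suc x ≤ᵇ c
evalCmp LE x c = x ≤ᵇ c
evalCmp GT x c = ℕ.suc c ≤ᵇ x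
evalCmp GE x c = c ≤ᵇ x

evalPred : ∀ {d} → Pred d → Point d → Bool
evalPred (pred j o c) x = evalCmp o (lookup x j) c

satPart : ∀ {d} → Pred d → Dataset d → Dataset d
satPart φ D = filterᵇ (evalPred φ) D

unsatPart : ∀ {d} → Pred d → Dataset d → Dataset d
unsatPart φ D = filterᵇ (λ x → not (evalPred φ x)) D

record LinClassifier (d : ℕ) : Set where
  constructor linC
  field
    w : Vec ℚ d
    b : ℚ

toℚ : ℕ → ℚ
toℚ n = (+ n) ℚ./ 1

dot : ∀ {d} → Vec ℚ d → Point d → ℚ
dot w x = Vec.foldr _ ℚ._+_ 0ℚ (Vec.zipWith (λ wi xi → wi ℚ.* toℚ xi) w x)

-- true = YES, false = NO
classify : ∀ {d} → LinClassifier d → Point d → Bool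
classify (linC w b) x = ⌊ b ≤? dot w x ⌋

data LeafLabel (d : ℕ) : Set where
  YES NO : LeafLabel d
  lin    : LinClassifier d → LeafLabel d

data DTree (d : ℕ) : Set where
  leaf : LeafLabel d → DTree d
  node : Pred d → DTree d → DTree d → DTree d   -- first child = sat

accepts : ∀ {d} → DTree d → Point d → Bool
accepts (leaf YES)     x = true
accepts (leaf NO)      x = false
accepts (leaf (lin c)) x = classify c x
accepts (node φ t₁ t₂) x = if evalPred φ x then accepts t₁ x else accepts t₂ x

-- Training set defined by a memoryless strategy π : S_i → A_i,
-- with S_i = Fin nS, A_i = Fin nA, val_s ∈ ℕ^dS, val_a ∈ ℕ^dA.

module Training {nS nA dS dA : ℕ}
                (valS : Fin nS → Vec ℕ dS) (valA : Fin nA → Vec ℕ dA)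
                (π : Fin nS → Fin nA) where

  d : ℕ
  d = dS + dA

  open DecMem (≡-dec {n = d} ℕ._≟_) using (_∈?_)

  pt : Fin nS → Fin nA → Point d
  pt s a = valS s ++ valA a

  Good : Dataset d
  Good = map (λ s → pt s (π s)) (allFin nS)

  Bad : Dataset d
  Bad = concatMap (λ s → map (pt s)
                    (filterᵇ (λ a → not ⌊ a Data.Fin.≟ π s ⌋) (allFin nA)))
                  (allFin nS)

  Train : Dataset d
  Train = Good List.++ Bad

  SubGood : Dataset d → Set
  SubGood D = All (_∈ Good) D

  SubBad : Dataset d → Set
  SubBad D = All (_∈ Bad) D

  SubTrain : Dataset d → Set
  SubTrain D = All (_∈ Train) D

  Separates : LinClassifier d → Dataset d → Set
  Separates c D = All (λ x → (classify c x ≡ true) ⇔ (x ∈ Good)) D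

  LinSeparable : Dataset d → Set
  LinSeparable D = ∃ λ c → Separates c D

  NonEmpty : Dataset d → Set
  NonEmpty D = ∃ λ x → x ∈ D

  SplitOK : List (Pred d) → (Dataset d → Pred d) → Set
  SplitOK Preds split =
    ∀ D → SubTrain D → ¬ SubGood D → ¬ SubBad D → ¬ LinSeparable D →
      (split D ∈ Preds) × NonEmpty (satPart (split D) D)
                        × NonEmpty (unsatPart (split D) D)

  majority : Dataset d → LeafLabel d
  majority D = if length (filterᵇ (λ x → ⌊ x ∈? Bad ⌋) D)
                   ≤ᵇ length (filterᵇ (λ x → ⌊ x ∈? Good ⌋) D)
               then YES else NO

  -- Algorithm LinDT, processing node (ℓ, D_ℓ) recursively, with fuel
  -- (nothing = fuel exhausted, i.e. not terminated within the bound).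
  -- sep is the separability test: it decides linear separability and in
  -- the positive case provides a separating classifier.
  linDT : (split : Dataset d → Pred d)
          (sep : (D : Dataset d) → Dec (LinSeparable D)) →
          ℕ → Dataset d → Maybe (DTree d)
  linDT split sep ℕ.zero D = nothing
  linDT split sep (ℕ.suc n) D with all? (_∈? Good) D | all? (_∈? Bad) D
  ... | yes _ | _     = just (leaf (majority D))
  ... | no _  | yes _ = just (leaf (majority D))
  ... | no _  | no _ with sep D
  ...   | yes (c , _) = just (leaf (lin c))
  ...   | no _ with linDT split sep n (satPart (split D) D)
                  | linDT split sep n (unsatPart (split D) D)
  ...     | just t₁ | just t₂ = just (node (split D) t₁ t₂)
  ...     | _       | _       = nothing

{-# OPTIONS --safe #-}
module Submission where

-- Run on a subset D of Train, LinDT either stops at a leaf that is correct on D (a pure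
-- dataset gets its majority label, a separable one its separating classifier) or splits D
-- into two nonempty, hence strictly smaller, parts; so fuel |D| + 1 suffices, and by
-- induction the tree is correct on all of D.  Applied to D = Train, correctness means
-- (s, a) ∈ L(T) ⇔ (s, a) ∈ Good ⇔ π s ≡ a, the last step because pt is injective.

open import Defs
open import Data.Bool using (Bool; true; false; not; T; T?)
open import Data.Bool.Properties using (T-≡; T-not-≡)
open import Data.Nat as ℕ using (ℕ; suc; _<_; s≤s)
open import Data.Nat.Properties using (≤-refl; <-≤-trans)
open import Data.Fin as Fin using (Fin)
open import Data.Vec using (Vec)
open import Data.Vec.Properties using (≡-dec; ++-injective)
open import Data.List using (List; []; _∷_; length; filterᵇ; allFin)
open import Data.List.Properties using (filter-notAll; filter-all; filter-none)
open import Data.List.Relation.Unary.All as All using (All; all?)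
open import Data.List.Relation.Unary.All.Properties using (filter⁺)
open import Data.List.Membership.Propositional using (_∈_; _∉_; lose; find)
import Data.List.Membership.DecPropositional as DecMembership
open import Data.List.Membership.Propositional.Properties
  using (∈-map⁺; ∈-map⁻; ∈-++⁺ˡ; ∈-++⁺ʳ; ∈-concatMap⁺; ∈-concatMap⁻; ∈-allFin; ∈-filter⁺; ∈-filter⁻)
open import Data.Maybe using (just)
open import Data.Product using (∃; _×_; _,_)
open import Data.Empty using (⊥-elim)
open import Function.Base using (_∘_)
open import Function.Bundles using (_⇔_; mk⇔; Equivalence)
open import Function.Definitions using (Injective)
import Function.Properties.Equivalence as ⇔
open import Relation.Nullary using (Dec; yes; no; ¬_)
open import Relation.Nullary.Decidable using (⌊_⌋; toWitness; fromWitness; toWitnessFalse; fromWitnessFalse)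
open import Relation.Binary.PropositionalEquality using (_≡_; _≢_; refl; cong; subst)

length-filterᵇ-< : ∀ {A : Set} (p : A → Bool) {x xs} →
                   x ∈ xs → p x ≡ false → length (filterᵇ p xs) < length xs
length-filterᵇ-< p {xs = xs} x∈xs px≡false = filter-notAll (T? ∘ p) xs (lose x∈xs (subst T px≡false))

module _ {d : ℕ} (φ : Pred d) (D : Dataset d) where

  satPart-< : ∀ {x} → x ∈ unsatPart φ D → length (satPart φ D) < length D
  satPart-< x∈unsat with x∈D , T¬φx ← ∈-filter⁻ (T? ∘ (not ∘ evalPred φ)) {xs = D} x∈unsat =
    length-filterᵇ-< (evalPred φ) x∈D (Equivalence.to T-not-≡ T¬φx)

  unsatPart-< : ∀ {x} → x ∈ satPart φ D → length (unsatPart φ D) < length D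
  unsatPart-< x∈sat with x∈D , Tφx ← ∈-filter⁻ (T? ∘ evalPred φ) {xs = D} x∈sat =
    length-filterᵇ-< (not ∘ evalPred φ) x∈D (cong not (Equivalence.to T-≡ Tφx))

Decides : ∀ {d} → DTree d → (Point d → Set) → Dataset d → Set
Decides T P D = All (λ x → (accepts T x ≡ true) ⇔ P x) D

module _ {d : ℕ} {P : Point d → Set} where

  leaf-YES-decides : ∀ {D} → All P D → Decides (leaf YES) P D
  leaf-YES-decides = All.map (λ Px → mk⇔ (λ _ → Px) (λ _ → refl))

  leaf-NO-decides : ∀ {D} → All (¬_ ∘ P) D → Decides (leaf NO) P D
  leaf-NO-decides = All.map (λ ¬Px → mk⇔ (λ ()) (⊥-elim ∘ ¬Px))

  node-decides : ∀ φ {T₁ T₂ D} → Decides T₁ P (satPart φ D) → Decides T₂ P (unsatPart φ D) →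
                 Decides (node φ T₁ T₂) P D
  node-decides φ {T₁} {T₂} {D} dec₁ dec₂ = All.tabulate branch
    where
    branch : ∀ {x} → x ∈ D → (accepts (node φ T₁ T₂) x ≡ true) ⇔ P x
    branch {x} x∈D with evalPred φ x in φx
    ... | true  = All.lookup dec₁ (∈-filter⁺ (T? ∘ evalPred φ) x∈D (Equivalence.from T-≡ φx))
    ... | false = All.lookup dec₂ (∈-filter⁺ (T? ∘ (not ∘ evalPred φ)) x∈D (Equivalence.from T-not-≡ φx))

module StrategyTraining {nS nA dS dA : ℕ}
    (valS : Fin nS → Vec ℕ dS) (valA : Fin nA → Vec ℕ dA)
    (valS-injective : Injective _≡_ _≡_ valS) (valA-injective : Injective _≡_ _≡_ valA)
    (π : Fin nS → Fin nA) where

  open Training valS valA π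
  open DecMembership (≡-dec {n = d} ℕ._≟_) using (_∈?_)

  pt-injective : ∀ {s a s′ a′} → pt s a ≡ pt s′ a′ → s ≡ s′ × a ≡ a′
  pt-injective {s} {s′ = s′} eq with valS≡ , valA≡ ← ++-injective (valS s) (valS s′) eq =
    valS-injective valS≡ , valA-injective valA≡

  ∈-Good⁻ : ∀ {x} → x ∈ Good → ∃ λ s → x ≡ pt s (π s)
  ∈-Good⁻ x∈Good with s , _ , eq ← ∈-map⁻ (λ s → pt s (π s)) x∈Good = s , eq

  ∈-Bad⁻ : ∀ {x} → x ∈ Bad → ∃ λ s → ∃ λ a → a ≢ π s × x ≡ pt s a
  ∈-Bad⁻ x∈Bad
    with s , _ , x∈row ← find (∈-concatMap⁻ _ {xs = allFin nS} x∈Bad)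
    with a , a∈ , eq ← ∈-map⁻ (pt s) x∈row
    with _ , a≢πs ← ∈-filter⁻ (λ a → T? (not ⌊ a Fin.≟ π s ⌋)) {xs = allFin nA} a∈
    = s , a , toWitnessFalse a≢πs , eq

  Good⇒∉Bad : ∀ {x} → x ∈ Good → x ∉ Bad
  Good⇒∉Bad x∈Good x∈Bad
    with s , refl ← ∈-Good⁻ x∈Good
    with _ , _ , a≢πs , eq ← ∈-Bad⁻ x∈Bad
    with refl , refl ← pt-injective eq
    = a≢πs refl

  Bad⇒∉Good : ∀ {x} → x ∈ Bad → x ∉ Good
  Bad⇒∉Good x∈Bad x∈Good = Good⇒∉Bad x∈Good x∈Bad

  pt-∈-Good⇔ : ∀ {s a} → pt s a ∈ Good ⇔ π s ≡ a
  pt-∈-Good⇔ {s} = mk⇔ to from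
    where
    to : ∀ {a} → pt s a ∈ Good → π s ≡ a
    to pt∈Good with _ , eq ← ∈-Good⁻ pt∈Good with refl , refl ← pt-injective eq = refl
    from : ∀ {a} → π s ≡ a → pt s a ∈ Good
    from refl = ∈-map⁺ (λ s → pt s (π s)) (∈-allFin s)

  pt-∈-Train : ∀ s a → pt s a ∈ Train
  pt-∈-Train s a with a Fin.≟ π s
  ... | yes refl = ∈-++⁺ˡ (Equivalence.from pt-∈-Good⇔ refl)
  ... | no a≢πs  = ∈-++⁺ʳ Good (∈-concatMap⁺ _ (lose (∈-allFin s) (∈-map⁺ (pt s) a∈row)))
    where
    a∈row : a ∈ filterᵇ (λ a′ → not ⌊ a′ Fin.≟ π s ⌋) (allFin nA)
    a∈row = ∈-filter⁺ (λ a → T? (not ⌊ a Fin.≟ π s ⌋)) (∈-allFin a) (fromWitnessFalse a≢πs)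

  majority-Good : ∀ {D} → SubGood D → majority D ≡ YES
  majority-Good D⊆Good
    rewrite filter-none (λ x → T? ⌊ x ∈? Bad ⌋) (All.map (λ x∈Good → Good⇒∉Bad x∈Good ∘ toWitness) D⊆Good)
    = refl

  majority-Bad : ∀ {D} → ¬ SubGood D → SubBad D → majority D ≡ NO
  majority-Bad {[]} D⊈Good _ = ⊥-elim (D⊈Good All.[])
  majority-Bad {x ∷ D} _ D⊆Bad
    rewrite filter-none (λ x → T? ⌊ x ∈? Good ⌋) (All.map (λ x∈Bad → Bad⇒∉Good x∈Bad ∘ toWitness) D⊆Bad)
          | filter-all (λ x → T? ⌊ x ∈? Bad ⌋) (All.map fromWitness D⊆Bad)
    = refl

  module _ {Preds : List (Pred d)} {split : Dataset d → Pred d}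
           (sep : (D : Dataset d) → Dec (LinSeparable D))
           (split-ok : SplitOK Preds split) where

    linDT-decides : ∀ n D → length D < n → SubTrain D →
                    ∃ λ T → linDT split sep n D ≡ just T × Decides T (_∈ Good) D
    linDT-decides (suc n) D (s≤s |D|≤n) D⊆Train with all? (_∈? Good) D | all? (_∈? Bad) D
    ... | yes D⊆Good | _ =
      leaf YES , cong (just ∘ leaf) (majority-Good D⊆Good) , leaf-YES-decides D⊆Good
    ... | no D⊈Good | yes D⊆Bad =
      leaf NO , cong (just ∘ leaf) (majority-Bad D⊈Good D⊆Bad) , leaf-NO-decides (All.map Bad⇒∉Good D⊆Bad)
    ... | no D⊈Good | no D⊈Bad with sep D
    ...   | yes (c , c-separates) = leaf (lin c) , refl , c-separates
    ...   | no D-inseparable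
      with _ , (_ , x∈sat) , (_ , y∈unsat) ← split-ok D D⊆Train D⊈Good D⊈Bad D-inseparable
      with T₁ , eq₁ , dec₁ ← linDT-decides n (satPart (split D) D)
             (<-≤-trans (satPart-< (split D) D y∈unsat) |D|≤n) (filter⁺ (T? ∘ evalPred (split D)) D⊆Train)
      with T₂ , eq₂ , dec₂ ← linDT-decides n (unsatPart (split D) D)
             (<-≤-trans (unsatPart-< (split D) D x∈sat) |D|≤n) (filter⁺ (T? ∘ (not ∘ evalPred (split D))) D⊆Train)
      rewrite eq₁ | eq₂
      = node (split D) T₁ T₂ , refl , node-decides (split D) {T₁} {T₂} {D} dec₁ dec₂

    linDT-represents-π : ∃ λ fuel → ∃ λ T →
      linDT split sep fuel Train ≡ just T × (∀ s a → (accepts T (pt s a) ≡ true) ⇔ (π s ≡ a))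
    linDT-represents-π
      with T , eq , T-decides-Good ←
             linDT-decides (suc (length Train)) Train ≤-refl (All.tabulate λ x∈Train → x∈Train)
      = suc (length Train) , T , eq , λ s a → ⇔.trans (All.lookup T-decides-Good (pt-∈-Train s a)) pt-∈-Good⇔

mainTheorem1 : ∀ {nS nA dS dA : ℕ}
    (valS : Fin nS → Vec ℕ dS) (valA : Fin nA → Vec ℕ dA) →
    Injective _≡_ _≡_ valS → Injective _≡_ _≡_ valA →
    (π : Fin nS → Fin nA) →
    (Preds : List (Pred (Training.d valS valA π))) →
    (split : Dataset (Training.d valS valA π) → Pred (Training.d valS valA π)) →
    (sep : (D : Dataset (Training.d valS valA π)) → Dec (Training.LinSeparable valS valA π D)) →
    Training.SplitOK valS valA π Preds split →
    ∃ λ fuel → ∃ λ T →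
      (Training.linDT valS valA π split sep fuel (Training.Train valS valA π) ≡ just T)
      × (∀ s a → (accepts T (Training.pt valS valA π s a) ≡ true) ⇔ (π s ≡ a))
mainTheorem1 valS valA valS-injective valA-injective π _ _ =
  StrategyTraining.linDT-represents-π valS valA valS-injective valA-injective π
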